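{- Let $n\ge1$, let $q$ be an even integer and $h$ an integer with $2^{h-1}<q\le 2^h$, let $\sigma$ be a permutation of $\mathbb{Z}_2^n$, let $p$ be a positive integer with $p\le h-1$, and let $a_0,\dots,a_{p-1}:\mathbb{Z}_2^n\to\mathbb{Z}_2$ be arbitrary Boolean functions. Consider $f:\mathbb{Z}_2^n\times\mathbb{Z}_2^n\to\mathbb{Z}_q$, $$f(x,y)=\tfrac q2\,x\cdot\sigma(y)+a_0(y)+2a_1(y)+\cdots+2^{p-1}a_{p-1}(y)\pmod q.$$ For $i=0,\dots,2^p-1$ let $z_i=(z_{i,0},\dots,z_{i,p-1})\in\mathbb{Z}_2^p$ be the binary vector with $i=\sum_jz_{i,j}2^j$, and let $g_i(x,y)=x\cdot\sigma(y)\oplus z_{i,0}a_0(y)\oplus\cdots\oplus z_{i,p-1}a_{p-1}(y)$, a Boolean function in $2n$ variables. Then every $g_i$ is bent, and for every $u\in\mathbb{Z}_2^{2n}$ there exist $r\in\{0,\dots,2^p-1\}$ and $\epsilon\in\{\pm1\}$ such that $(W_{g_0}(u),\dots,W_{g_{2^p-1}}(u))=\epsilon H^{(r)}_{2^p}$.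
   Context: For a Boolean function $g$ on $\mathbb{Z}_2^m$, $W_g(u)=2^{ -m/2}\sum_{w\in\mathbb{Z}_2^m}(-1)^{g(w)\oplus u\cdot w}$, where $\cdot$ is the inner product over $\mathbb{Z}_2$; $g$ is bent if $|W_g(u)|=1$ for all $u$. $H^{(r)}_{2^p}$ denotes the $r$-th row (indexed from $0$) of the Sylvester–Hadamard matrix, defined by $H_1=(1)$, $H_{2^p}=\begin{pmatrix}H_{2^{p-1}}&H_{2^{p-1}}\\H_{2^{p-1}}&-H_{2^{p-1}}\end{pmatrix}$. -}

module Defs where

open import Data.Bool using (Bool; true; false; _xor_; _∧_; if_then_else_)
open import Data.Nat as ℕ using (ℕ; zero; suc; _^_; _%_; _/_; _≡ᵇ_)
open import Data.Nat.Properties using (m^n≢0)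
open import Data.Integer as ℤ using (ℤ; +_; -_)
open import Data.Rational as ℚ using (ℚ)
open import Data.List as List using (List; []; _∷_; concatMap; map)
open import Data.Vec as Vec using (Vec; []; _∷_; _++_; zipWith)
open import Data.Product using (_×_; _,_)
open import Data.Fin as Fin using (Fin; toℕ)
open import Relation.Binary.PropositionalEquality using (_≡_)

dot : ∀ {m} → Vec Bool m → Vec Bool m → Bool
dot []       []       = false
dot (a ∷ as) (b ∷ bs) = (a ∧ b) xor dot as bs

allVecs : (m : ℕ) → List (Vec Bool m)
allVecs zero    = [] ∷ []
allVecs (suc m) = map (false ∷_) (allVecs m) List.++ map (true ∷_) (allVecs m)

sgn : Bool → ℤ
sgn false = + 1
sgn true  = - (+ 1)

-- Z_2^{2n} written as Z_2^n × Z_2^n (coordinates (x,y)); inner product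
-- (u₁,u₂)·(x,y) = u₁·x ⊕ u₂·y.
dot2 : ∀ {n} → Vec Bool n × Vec Bool n → Vec Bool n × Vec Bool n → Bool
dot2 (u₁ , u₂) (x , y) = dot u₁ x xor dot u₂ y

walshSum : ∀ {n} → (Vec Bool n × Vec Bool n → Bool) → Vec Bool n × Vec Bool n → ℤ
walshSum {n} g u =
  List.foldr ℤ._+_ (+ 0)
    (concatMap (λ x → map (λ y → sgn (g (x , y) xor dot2 u (x , y))) (allVecs n)) (allVecs n))

-- Walsh–Hadamard transform of a Boolean function in m = 2n variables:
-- W_g(u) = 2^{-m/2} Σ_w (-1)^{g(w) ⊕ u·w} = 2^{-n} Σ_w ... (a rational number).
W : ∀ {n} → (Vec Bool n × Vec Bool n → Bool) → Vec Bool n × Vec Bool n → ℚ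
W {n} g u = ℚ._/_ (walshSum g u) (2 ^ n) {{m^n≢0 2 n}}

IsBent : ∀ {n} → (Vec Bool n × Vec Bool n → Bool) → Set
IsBent {n} g = ∀ (u : Vec Bool n × Vec Bool n) → ℚ.∣ W g u ∣ ≡ ℚ.1ℚ

-- Sylvester–Hadamard matrix H_{2^p}, as a 2^p × 2^p matrix of ±1 (list of rows).
-- H_1 = (1),  H_{2^{p+1}} = [[H, H], [H, -H]].
-- (Row length 2^p + (2^p + 0) is definitionally 2 ^ suc p.)
hadamard : (p : ℕ) → Vec (Vec ℤ (2 ^ p)) (2 ^ p)
hadamard zero    = ((+ 1) ∷ []) ∷ []
hadamard (suc p) =
  zipWith (λ r s → r ++ (s ++ [])) (hadamard p) (hadamard p)
  ++ (zipWith (λ r s → r ++ (Vec.map -_ s ++ [])) (hadamard p) (hadamard p) ++ [])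

hadamardRow : (p : ℕ) → Fin (2 ^ p) → Vec ℤ (2 ^ p)
hadamardRow p r = Vec.lookup (hadamard p) r

-- Binary expansion: bits p i = (z_0, …, z_{p-1}) with i ≡ Σ_j z_j 2^j (mod 2^p),
-- z_0 the least significant bit.
bits : (p : ℕ) → ℕ → Vec Bool p
bits zero    i = []
bits (suc p) i = (i % 2 ≡ᵇ 1) ∷ bits p (i / 2)

combo : ∀ {n p} → Vec Bool p → (Fin p → Vec Bool n → Bool) → Vec Bool n → Bool
combo []       a y = false
combo (z ∷ zs) a y = (z ∧ a Fin.zero y) xor combo zs (λ j → a (Fin.suc j)) y

gFun : ∀ {n p} → (Vec Bool n → Vec Bool n) → (Fin p → Vec Bool n → Bool)
     → Fin (2 ^ p) → Vec Bool n × Vec Bool n → Bool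
gFun {n} {p} σ a i (x , y) = dot x (σ y) xor combo (bits p (toℕ i)) a y

-- Each g_i is a Maiorana–McFarland function x·σ(y) ⊕ c_i(y) with
-- c_i(y) = z_i · A(y), where A(y) = (a_0(y), …, a_{p-1}(y)).  In the Walsh sum
-- at u = (u₁, u₂) the sum over x is a character sum, which vanishes unless
-- σ(y) = u₁; so only y₀ = σ⁻¹(u₁) survives and W_{g_i}(u) = (-1)^{c_i(y₀) ⊕ u₂·y₀},
-- which makes g_i bent.  The Sylvester–Hadamard matrix has entries
-- H_{r,i} = (-1)^{z_r · z_i}, so the Walsh vector at u is (-1)^{u₂·y₀} times the
-- row of H whose binary index is A(y₀).
module Submission where

open import Defs
open import Algebra.Bundles using (CommutativeRing)
import Algebra.Properties.CommutativeSemigroup as CommutativeSemigroupProperties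
open import Data.Bool using (Bool; true; false; _xor_; _∧_; not; if_then_else_)
import Data.Bool.Properties as Boolₚ
open import Data.Empty using (⊥-elim)
open import Data.Fin as Fin using (Fin; toℕ; fromℕ<; _↑ˡ_; _↑ʳ_; join; splitAt)
import Data.Fin.Properties as Finₚ
open import Data.Integer as ℤ using (ℤ; +_; -_; _+_; _*_)
import Data.Integer.Properties as ℤₚ
open import Data.List as List using (List; []; _∷_; concatMap; map)
import Data.List.Properties as Listₚ
open import Data.Nat as ℕ using (ℕ; zero; suc; _≤_; _<_; _∸_; _^_; _%_; _/_; _≡ᵇ_; NonZero; z≤n; s≤s)
open import Data.Nat.Divisibility using (_∣_; divides-refl)
open import Data.Nat.DivMod using ([m+kn]%n≡m%n; +-distrib-/-∣ʳ; m*n/n≡m; m<n*o⇒m/o<n)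
import Data.Nat.Properties as ℕₚ
open import Data.Product using (_×_; _,_; ∃-syntax)
import Data.Rational as ℚ
import Data.Rational.Properties as ℚₚ
import Data.Rational.Unnormalised as ℚᵘ
open import Data.Sum using (_⊎_; inj₁; inj₂)
open import Data.Vec as Vec using (Vec; []; _∷_; _++_; _∷ʳ_; lookup; zipWith; tabulate)
import Data.Vec.Properties as Vecₚ
open import Function using (_∘_)
open import Function.Bundles using (_↔_; Inverse)
open import Relation.Binary.PropositionalEquality

module ℤ+ = CommutativeSemigroupProperties ℤₚ.+-commutativeSemigroup
module ⊕ = CommutativeSemigroupProperties
  (CommutativeRing.+-commutativeSemigroup Boolₚ.xor-∧-commutativeRing)

private
  variable
    X : Set
    n m p : ℕ

-- Finite sums

sumℤ : List ℤ → ℤ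
sumℤ = List.foldr _+_ (+ 0)

sumℤ-++ : ∀ xs ys → sumℤ (xs List.++ ys) ≡ sumℤ xs + sumℤ ys
sumℤ-++ []       ys = sym (ℤₚ.+-identityˡ _)
sumℤ-++ (x ∷ xs) ys = trans (cong (_+_ x) (sumℤ-++ xs ys)) (sym (ℤₚ.+-assoc x _ _))

sumℤ-concatMap : ∀ (f : X → List ℤ) xs → sumℤ (concatMap f xs) ≡ sumℤ (map (sumℤ ∘ f) xs)
sumℤ-concatMap f []       = refl
sumℤ-concatMap f (x ∷ xs) =
  trans (sumℤ-++ (f x) (concatMap f xs)) (cong (_+_ (sumℤ (f x))) (sumℤ-concatMap f xs))

sumℤ-map-zero : ∀ {f : X → ℤ} → (∀ x → f x ≡ + 0) → ∀ xs → sumℤ (map f xs) ≡ + 0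
sumℤ-map-zero f≡0 []       = refl
sumℤ-map-zero f≡0 (x ∷ xs) = cong₂ _+_ (f≡0 x) (sumℤ-map-zero f≡0 xs)

sumℤ-map-+ : ∀ (f g : X → ℤ) xs →
             sumℤ (map (λ x → f x + g x) xs) ≡ sumℤ (map f xs) + sumℤ (map g xs)
sumℤ-map-+ f g []       = refl
sumℤ-map-+ f g (x ∷ xs) =
  trans (cong (_+_ (f x + g x)) (sumℤ-map-+ f g xs)) (ℤ+.interchange (f x) (g x) _ _)

sumℤ-map-neg : ∀ (f : X → ℤ) xs → sumℤ (map (-_ ∘ f) xs) ≡ - sumℤ (map f xs)
sumℤ-map-neg f []       = refl
sumℤ-map-neg f (x ∷ xs) =
  trans (cong (_+_ (- f x)) (sumℤ-map-neg f xs)) (sym (ℤₚ.neg-distrib-+ (f x) _))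

sumℤ-map-*ʳ : ∀ (f : X → ℤ) c xs → sumℤ (map (λ x → f x * c) xs) ≡ sumℤ (map f xs) * c
sumℤ-map-*ʳ f c []       = refl
sumℤ-map-*ʳ f c (x ∷ xs) =
  trans (cong (_+_ (f x * c)) (sumℤ-map-*ʳ f c xs)) (sym (ℤₚ.*-distribʳ-+ c (f x) _))

sumℤ-map-swap : ∀ {B : Set} (F : X → B → ℤ) xs ys →
                sumℤ (map (λ x → sumℤ (map (F x) ys)) xs)
                  ≡ sumℤ (map (λ y → sumℤ (map (λ x → F x y) xs)) ys)
sumℤ-map-swap F []       ys = sym (sumℤ-map-zero (λ _ → refl) ys)
sumℤ-map-swap F (x ∷ xs) ys =
  trans (cong (_+_ (sumℤ (map (F x) ys))) (sumℤ-map-swap F xs ys))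
        (sym (sumℤ-map-+ (F x) (λ y → sumℤ (map (λ x → F x y) xs)) ys))

∑ : (Vec Bool n → ℤ) → ℤ
∑ {n} f = sumℤ (map f (allVecs n))

∑-cong : ∀ {f g : Vec Bool n → ℤ} → (∀ x → f x ≡ g x) → ∑ f ≡ ∑ g
∑-cong {n} f≡g = cong sumℤ (Listₚ.map-cong f≡g (allVecs n))

∑-split : (f : Vec Bool (suc n) → ℤ) → ∑ f ≡ ∑ (f ∘ (false ∷_)) + ∑ (f ∘ (true ∷_))
∑-split {n} f = begin
  sumℤ (map f (map (false ∷_) xs List.++ map (true ∷_) xs))
    ≡⟨ cong sumℤ (Listₚ.map-++ f (map (false ∷_) xs) _) ⟩
  sumℤ (map f (map (false ∷_) xs) List.++ map f (map (true ∷_) xs))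
    ≡⟨ sumℤ-++ (map f (map (false ∷_) xs)) _ ⟩
  sumℤ (map f (map (false ∷_) xs)) + sumℤ (map f (map (true ∷_) xs))
    ≡⟨ cong₂ (λ ys zs → sumℤ ys + sumℤ zs) (Listₚ.map-∘ xs) (Listₚ.map-∘ xs) ⟨
  ∑ (f ∘ (false ∷_)) + ∑ (f ∘ (true ∷_)) ∎
  where
  open ≡-Reasoning
  xs : List (Vec Bool n)
  xs = allVecs n

∑-zero : ∀ {f : Vec Bool n → ℤ} → (∀ x → f x ≡ + 0) → ∑ f ≡ + 0
∑-zero {n} f≡0 = sumℤ-map-zero f≡0 (allVecs n)

∑-neg : (f : Vec Bool n → ℤ) → ∑ (-_ ∘ f) ≡ - ∑ f
∑-neg {n} f = sumℤ-map-neg f (allVecs n)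

∑-*ʳ : (f : Vec Bool n → ℤ) (c : ℤ) → ∑ (λ x → f x * c) ≡ ∑ f * c
∑-*ʳ {n} f c = sumℤ-map-*ʳ f c (allVecs n)

∑-swap : (F : Vec Bool n → Vec Bool m → ℤ) → ∑ (λ x → ∑ (F x)) ≡ ∑ (λ y → ∑ (λ x → F x y))
∑-swap {n} {m} F = sumℤ-map-swap F (allVecs n) (allVecs m)

∑-one : ∑ {n} (λ _ → + 1) ≡ + (2 ^ n)
∑-one {zero}  = refl
∑-one {suc n} = trans (∑-split {n} (λ _ → + 1))
  (cong₂ _+_ (∑-one {n}) (trans (∑-one {n}) (cong +_ (sym (ℕₚ.+-identityʳ _)))))

∑-single : (f : Vec Bool n → ℤ) (y₀ : Vec Bool n) →
           (∀ y → y ≢ y₀ → f y ≡ + 0) → ∑ f ≡ f y₀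
∑-single f []            _      = ℤₚ.+-identityʳ (f [])
∑-single f (false ∷ y₀) f≡0 = trans (∑-split f) (trans
  (cong₂ _+_ (∑-single (f ∘ (false ∷_)) y₀ (λ y y≢y₀ → f≡0 _ (y≢y₀ ∘ Vecₚ.∷-injectiveʳ)))
             (∑-zero (λ y → f≡0 (true ∷ y) λ ())))
  (ℤₚ.+-identityʳ _))
∑-single f (true ∷ y₀)  f≡0 = trans (∑-split f) (trans
  (cong₂ _+_ (∑-zero (λ y → f≡0 (false ∷ y) λ ()))
             (∑-single (f ∘ (true ∷_)) y₀ (λ y y≢y₀ → f≡0 _ (y≢y₀ ∘ Vecₚ.∷-injectiveʳ))))
  (ℤₚ.+-identityˡ _))

-- Characters of ℤ₂ⁿ

sgn-xor : ∀ a b → sgn (a xor b) ≡ sgn a * sgn b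
sgn-xor false false = refl
sgn-xor false true  = refl
sgn-xor true  false = refl
sgn-xor true  true  = refl

sgn-not : ∀ a → sgn (not a) ≡ - sgn a
sgn-not false = refl
sgn-not true  = refl

sgn-±1 : ∀ a → sgn a ≡ + 1 ⊎ sgn a ≡ - (+ 1)
sgn-±1 false = inj₁ refl
sgn-±1 true  = inj₂ refl

dot-comm : (x y : Vec Bool n) → dot x y ≡ dot y x
dot-comm []       []       = refl
dot-comm (a ∷ x) (b ∷ y) = cong₂ _xor_ (Boolₚ.∧-comm a b) (dot-comm x y)

dot-∷ʳ : (x y : Vec Bool n) (b c : Bool) → dot (x ∷ʳ b) (y ∷ʳ c) ≡ (b ∧ c) xor dot x y
dot-∷ʳ []      []      b c = refl
dot-∷ʳ (a ∷ x) (a′ ∷ y) b c =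
  trans (cong ((a ∧ a′) xor_) (dot-∷ʳ x y b c)) (⊕.x∙yz≈y∙xz (a ∧ a′) (b ∧ c) (dot x y))

∑-character-self : (v : Vec Bool n) → ∑ (λ x → sgn (dot x v xor dot x v)) ≡ + (2 ^ n)
∑-character-self {n} v = trans (∑-cong (λ x → cong sgn (Boolₚ.xor-same (dot x v)))) (∑-one {n})

∑-character-≢ : {v u : Vec Bool n} → v ≢ u → ∑ (λ x → sgn (dot x v xor dot x u)) ≡ + 0
∑-character-≢ {zero}  {[]}    {[]}    v≢u = ⊥-elim (v≢u refl)
∑-character-≢ {suc n} {b ∷ v} {c ∷ u} v≢u =
  trans (∑-split (λ x → sgn (dot x (b ∷ v) xor dot x (c ∷ u)))) (halves b c v≢u)
  where
  S : ℤ
  S = ∑ (λ x → sgn (dot x v xor dot x u))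

  cancel : ∀ {f} → (∀ x → f x ≡ - sgn (dot x v xor dot x u)) → S + ∑ f ≡ + 0
  cancel f≡ = trans (cong (_+_ S) (trans (∑-cong f≡) (∑-neg {n} (λ x → sgn (dot x v xor dot x u)))))
                    (ℤₚ.+-inverseʳ S)

  halves : ∀ b c → b ∷ v ≢ c ∷ u →
           S + ∑ (λ x → sgn ((b xor dot x v) xor (c xor dot x u))) ≡ + 0
  halves false false ne = cong₂ _+_ S≡0 S≡0
    where
    S≡0 : S ≡ + 0
    S≡0 = ∑-character-≢ (ne ∘ cong (false ∷_))
  halves true  true  ne = cong₂ _+_ S≡0
    (trans (∑-cong (λ x → cong sgn (Boolₚ.xor-annihilates-not (dot x v) (dot x u)))) S≡0)
    where
    S≡0 : S ≡ + 0
    S≡0 = ∑-character-≢ (ne ∘ cong (true ∷_))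
  halves false true  _  = cancel λ x →
    trans (cong sgn (sym (Boolₚ.not-distribʳ-xor (dot x v) (dot x u))))
          (sgn-not (dot x v xor dot x u))
  halves true  false _  = cancel λ x →
    trans (cong sgn (sym (Boolₚ.not-distribˡ-xor (dot x v) (dot x u))))
          (sgn-not (dot x v xor dot x u))

-- Walsh spectrum of Maiorana–McFarland functions

maioranaMcFarland : (Vec Bool n → Vec Bool n) → (Vec Bool n → Bool) →
                    Vec Bool n × Vec Bool n → Bool
maioranaMcFarland π c (x , y) = dot x (π y) xor c y

module _ (σ : Vec Bool n ↔ Vec Bool n) (c : Vec Bool n → Bool) (u₁ u₂ : Vec Bool n) where
  open Inverse σ using (to; from; strictlyInverseˡ; strictlyInverseʳ)

  private
    y₀ : Vec Bool n
    y₀ = from u₁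

    s : Vec Bool n → ℤ
    s y = sgn (c y xor dot u₂ y)

    χ : Vec Bool n → ℤ
    χ y = ∑ (λ x → sgn (dot x (to y) xor dot x u₁))

    summand : ∀ x y → sgn (maioranaMcFarland to c (x , y) xor dot2 (u₁ , u₂) (x , y))
                      ≡ sgn (dot x (to y) xor dot x u₁) * s y
    summand x y = begin
      sgn ((dot x (to y) xor c y) xor (dot u₁ x xor dot u₂ y))
        ≡⟨ cong (λ d → sgn ((dot x (to y) xor c y) xor (d xor dot u₂ y))) (dot-comm u₁ x) ⟩
      sgn ((dot x (to y) xor c y) xor (dot x u₁ xor dot u₂ y))
        ≡⟨ cong sgn (⊕.interchange (dot x (to y)) (c y) (dot x u₁) (dot u₂ y)) ⟩
      sgn ((dot x (to y) xor dot x u₁) xor (c y xor dot u₂ y))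
        ≡⟨ sgn-xor (dot x (to y) xor dot x u₁) (c y xor dot u₂ y) ⟩
      sgn (dot x (to y) xor dot x u₁) * s y ∎
      where open ≡-Reasoning

    χ-off-y₀ : ∀ y → y ≢ y₀ → χ y * s y ≡ + 0
    χ-off-y₀ y y≢y₀ = trans (cong (_* s y) (∑-character-≢ {n} to-y≢u₁)) (ℤₚ.*-zeroˡ (s y))
      where
      to-y≢u₁ : to y ≢ u₁
      to-y≢u₁ eq = y≢y₀ (trans (sym (strictlyInverseʳ y)) (cong from eq))

    χ-y₀ : χ y₀ ≡ + (2 ^ n)
    χ-y₀ = subst (λ v → ∑ (λ x → sgn (dot x v xor dot x u₁)) ≡ + (2 ^ n))
                 (sym (strictlyInverseˡ u₁)) (∑-character-self u₁)

  walshSum-maioranaMcFarland :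
    walshSum (maioranaMcFarland to c) (u₁ , u₂) ≡ + (2 ^ n) * sgn (c y₀ xor dot u₂ y₀)
  walshSum-maioranaMcFarland = begin
    walshSum (maioranaMcFarland to c) (u₁ , u₂)
      ≡⟨ sumℤ-concatMap (λ x → map (λ y → term x y) (allVecs n)) (allVecs n) ⟩
    ∑ (λ x → ∑ (λ y → term x y))
      ≡⟨ ∑-cong (λ x → ∑-cong (summand x)) ⟩
    ∑ (λ x → ∑ (λ y → sgn (dot x (to y) xor dot x u₁) * s y))
      ≡⟨ ∑-swap (λ x y → sgn (dot x (to y) xor dot x u₁) * s y) ⟩
    ∑ (λ y → ∑ (λ x → sgn (dot x (to y) xor dot x u₁) * s y))
      ≡⟨ ∑-cong (λ y → ∑-*ʳ (λ x → sgn (dot x (to y) xor dot x u₁)) (s y)) ⟩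
    ∑ (λ y → χ y * s y)
      ≡⟨ ∑-single (λ y → χ y * s y) y₀ χ-off-y₀ ⟩
    χ y₀ * s y₀
      ≡⟨ cong (_* s y₀) χ-y₀ ⟩
    + (2 ^ n) * s y₀ ∎
    where
    open ≡-Reasoning
    term : Vec Bool n → Vec Bool n → ℤ
    term x y = sgn (maioranaMcFarland to c (x , y) xor dot2 (u₁ , u₂) (x , y))

+d*i/d≡i/1 : ∀ d .{{_ : NonZero d}} i → (+ d * i) ℚ./ d ≡ i ℚ./ 1
+d*i/d≡i/1 (suc d-1) i = ℚₚ.fromℚᵘ-cong {ℚᵘ.mkℚᵘ (+ suc d-1 * i) d-1} {ℚᵘ.mkℚᵘ i 0}
  (ℚᵘ.*≡* (trans (ℤₚ.*-identityʳ _) (ℤₚ.*-comm (+ suc d-1) i)))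

W-maioranaMcFarland : (σ : Vec Bool n ↔ Vec Bool n) (c : Vec Bool n → Bool) (u₁ u₂ : Vec Bool n) →
  let y₀ = Inverse.from σ u₁ in
  W (maioranaMcFarland (Inverse.to σ) c) (u₁ , u₂) ≡ sgn (c y₀ xor dot u₂ y₀) ℚ./ 1
W-maioranaMcFarland {n} σ c u₁ u₂ =
  trans (cong (λ i → (i ℚ./ 2 ^ n) {{ℕₚ.m^n≢0 2 n}}) (walshSum-maioranaMcFarland σ c u₁ u₂))
        (+d*i/d≡i/1 (2 ^ n) {{ℕₚ.m^n≢0 2 n}} _)

∣sgn/1∣≡1 : ∀ a → ℚ.∣ sgn a ℚ./ 1 ∣ ≡ ℚ.1ℚ
∣sgn/1∣≡1 false = refl
∣sgn/1∣≡1 true  = refl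

-- Binary expansions and the Sylvester–Hadamard matrix

bit : Bool → ℕ
bit false = 0
bit true  = 1

bits-suc : ∀ p j k → bits (suc p) (j ℕ.+ k ℕ.* 2) ≡ (j % 2 ≡ᵇ 1) ∷ bits p (j / 2 ℕ.+ k)
bits-suc p j k = cong₂ (λ r q → (r ≡ᵇ 1) ∷ bits p q) ([m+kn]%n≡m%n j k 2)
  (trans (+-distrib-/-∣ʳ j (divides-refl k)) (cong (j / 2 ℕ.+_) (m*n/n≡m k 2)))

fromBits : Vec Bool p → ℕ
fromBits []      = 0
fromBits (b ∷ v) = bit b ℕ.+ fromBits v ℕ.* 2

fromBits<2^p : (v : Vec Bool p) → fromBits v < 2 ^ p
fromBits<2^p []          = s≤s z≤n
fromBits<2^p {suc p} (b ∷ v) = begin-strict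
  bit b ℕ.+ fromBits v ℕ.* 2 <⟨ ℕₚ.+-monoˡ-< (fromBits v ℕ.* 2) (bit<2 b) ⟩
  suc (fromBits v) ℕ.* 2      ≤⟨ ℕₚ.*-monoˡ-≤ 2 (fromBits<2^p v) ⟩
  2 ^ p ℕ.* 2                 ≡⟨ ℕₚ.*-comm (2 ^ p) 2 ⟩
  2 ^ suc p                   ∎
  where
  open ℕₚ.≤-Reasoning
  bit<2 : ∀ b → bit b < 2
  bit<2 false = s≤s z≤n
  bit<2 true  = s≤s (s≤s z≤n)

bits-fromBits : (v : Vec Bool p) → bits p (fromBits v) ≡ v
bits-fromBits []          = refl
bits-fromBits (false ∷ v) = trans (bits-suc _ 0 (fromBits v)) (cong (false ∷_) (bits-fromBits v))
bits-fromBits (true ∷ v)  = trans (bits-suc _ 1 (fromBits v)) (cong (true ∷_) (bits-fromBits v))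

fromBitsᶠ : Vec Bool p → Fin (2 ^ p)
fromBitsᶠ v = fromℕ< (fromBits<2^p v)

bits-fromBitsᶠ : (v : Vec Bool p) → bits p (toℕ (fromBitsᶠ v)) ≡ v
bits-fromBitsᶠ {p} v = trans (cong (bits p) (Finₚ.toℕ-fromℕ< (fromBits<2^p v))) (bits-fromBits v)

bits-∷ʳ : ∀ p b j → j < 2 ^ p → bits (suc p) (bit b ℕ.* 2 ^ p ℕ.+ j) ≡ bits p j ∷ʳ b
bits-∷ʳ zero    false zero _ = refl
bits-∷ʳ zero    true  zero _ = refl
bits-∷ʳ zero    _     (suc j) (s≤s ())
bits-∷ʳ (suc p) b     j    j<2^p = begin
  bits (2 ℕ.+ p) (bit b ℕ.* 2 ^ suc p ℕ.+ j)
    ≡⟨ cong (bits (2 ℕ.+ p)) reorder ⟩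
  bits (2 ℕ.+ p) (j ℕ.+ bit b ℕ.* 2 ^ p ℕ.* 2)
    ≡⟨ bits-suc (suc p) j (bit b ℕ.* 2 ^ p) ⟩
  (j % 2 ≡ᵇ 1) ∷ bits (suc p) (j / 2 ℕ.+ bit b ℕ.* 2 ^ p)
    ≡⟨ cong (λ k → (j % 2 ≡ᵇ 1) ∷ bits (suc p) k) (ℕₚ.+-comm (j / 2) _) ⟩
  (j % 2 ≡ᵇ 1) ∷ bits (suc p) (bit b ℕ.* 2 ^ p ℕ.+ j / 2)
    ≡⟨ cong ((j % 2 ≡ᵇ 1) ∷_) (bits-∷ʳ p b (j / 2) j/2<2^p) ⟩
  (j % 2 ≡ᵇ 1) ∷ (bits p (j / 2) ∷ʳ b) ∎
  where
  open ≡-Reasoning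
  reorder : bit b ℕ.* 2 ^ suc p ℕ.+ j ≡ j ℕ.+ bit b ℕ.* 2 ^ p ℕ.* 2
  reorder = trans (ℕₚ.+-comm _ j)
    (cong (j ℕ.+_) (trans (cong (bit b ℕ.*_) (ℕₚ.*-comm 2 (2 ^ p))) (sym (ℕₚ.*-assoc (bit b) (2 ^ p) 2))))
  j/2<2^p : j / 2 < 2 ^ p
  j/2<2^p = m<n*o⇒m/o<n (subst (j <_) (ℕₚ.*-comm 2 (2 ^ p)) j<2^p)

-- Fin (2 ^ suc p) is definitionally Fin (2 ^ p + (2 ^ p + 0)), the index set
-- of the block decomposition in the definition of hadamard.
block : Bool → Fin m → Fin (m ℕ.+ (m ℕ.+ 0))
block {m} false i = i ↑ˡ (m ℕ.+ 0)
block {m} true  i = m ↑ʳ (i ↑ˡ 0)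

toℕ-block : ∀ b (i : Fin m) → toℕ (block b i) ≡ bit b ℕ.* m ℕ.+ toℕ i
toℕ-block     false i = Finₚ.toℕ-↑ˡ i _
toℕ-block {m} true  i = begin
  toℕ (m ↑ʳ (i ↑ˡ 0))  ≡⟨ Finₚ.toℕ-↑ʳ m (i ↑ˡ 0) ⟩
  m ℕ.+ toℕ (i ↑ˡ 0)   ≡⟨ cong₂ ℕ._+_ (sym (ℕₚ.+-identityʳ m)) (Finₚ.toℕ-↑ˡ i 0) ⟩
  m ℕ.+ 0 ℕ.+ toℕ i    ∎
  where open ≡-Reasoning

lookup-block : (xs ys : Vec X m) (b : Bool) (i : Fin m) →
               lookup (xs ++ (ys ++ [])) (block b i) ≡ lookup (if b then ys else xs) i
lookup-block xs ys false i = Vecₚ.lookup-++ˡ xs (ys ++ []) i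
lookup-block xs ys true  i = trans (Vecₚ.lookup-++ʳ xs (ys ++ []) (i ↑ˡ 0)) (Vecₚ.lookup-++ˡ ys [] i)

data BlockView {m} : Fin (m ℕ.+ (m ℕ.+ 0)) → Set where
  block-view : ∀ b (i : Fin m) → BlockView (block b i)

blockView : (i : Fin (m ℕ.+ (m ℕ.+ 0))) → BlockView i
blockView {m} i = subst (BlockView {m}) (Finₚ.join-splitAt m _ i) (fromSplit (splitAt m i))
  where
  fromLowerSplit : (k : Fin m ⊎ Fin 0) → BlockView {m} (m ↑ʳ join m 0 k)
  fromLowerSplit (inj₁ r) = block-view true r

  fromSplit : (k : Fin m ⊎ Fin (m ℕ.+ 0)) → BlockView {m} (join m (m ℕ.+ 0) k)
  fromSplit (inj₁ r) = block-view false r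
  fromSplit (inj₂ j) = subst (BlockView {m} ∘ (m ↑ʳ_)) (Finₚ.join-splitAt m 0 j)
                             (fromLowerSplit (splitAt m j))

bits-block : ∀ b (r : Fin (2 ^ p)) → bits (suc p) (toℕ (block b r)) ≡ bits p (toℕ r) ∷ʳ b
bits-block {p} b r = trans (cong (bits (suc p)) (toℕ-block b r)) (bits-∷ʳ p b (toℕ r) (Finₚ.toℕ<n r))

hadamardRow-block : ∀ p b (r : Fin (2 ^ p)) → let R = hadamardRow p r in
  hadamardRow (suc p) (block b r) ≡ R ++ ((if b then Vec.map -_ R else R) ++ [])
hadamardRow-block p b r = trans (lookup-block upper lower b r) (halves b)
  where
  H : Vec (Vec ℤ (2 ^ p)) (2 ^ p)
  H = hadamard p
  upper lower : Vec (Vec ℤ (2 ^ suc p)) (2 ^ p)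
  upper = zipWith (λ r s → r ++ (s ++ [])) H H
  lower = zipWith (λ r s → r ++ (Vec.map -_ s ++ [])) H H
  R : Vec ℤ (2 ^ p)
  R = hadamardRow p r

  halves : ∀ b → lookup (if b then lower else upper) r ≡ R ++ ((if b then Vec.map -_ R else R) ++ [])
  halves false = Vecₚ.lookup-zipWith (λ r s → r ++ (s ++ [])) r H H
  halves true  = Vecₚ.lookup-zipWith (λ r s → r ++ (Vec.map -_ s ++ [])) r H H

hadamard-block : ∀ p b c (r i : Fin (2 ^ p)) →
  lookup (hadamardRow (suc p) (block b r)) (block c i) ≡ sgn (b ∧ c) * lookup (hadamardRow p r) i
hadamard-block p b c r i = begin
  lookup (hadamardRow (suc p) (block b r)) (block c i)
    ≡⟨ cong (λ row → lookup row (block c i)) (hadamardRow-block p b r) ⟩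
  lookup (R ++ (R′ b ++ [])) (block c i)
    ≡⟨ lookup-block R (R′ b) c i ⟩
  lookup (if c then R′ b else R) i
    ≡⟨ signs b c ⟩
  sgn (b ∧ c) * lookup R i ∎
  where
  open ≡-Reasoning
  R : Vec ℤ (2 ^ p)
  R = hadamardRow p r
  R′ : Bool → Vec ℤ (2 ^ p)
  R′ b = if b then Vec.map -_ R else R

  signs : ∀ b c → lookup (if c then R′ b else R) i ≡ sgn (b ∧ c) * lookup R i
  signs false false = sym (ℤₚ.*-identityˡ _)
  signs false true  = sym (ℤₚ.*-identityˡ _)
  signs true  false = sym (ℤₚ.*-identityˡ _)
  signs true  true  = trans (Vecₚ.lookup-map i -_ R) (sym (ℤₚ.-1*i≡-i _))

hadamard-entry : ∀ p (r i : Fin (2 ^ p)) →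
                 lookup (hadamardRow p r) i ≡ sgn (dot (bits p (toℕ r)) (bits p (toℕ i)))
hadamard-entry zero    Fin.zero Fin.zero = refl
hadamard-entry (suc p) r i with blockView {2 ^ p} r | blockView {2 ^ p} i
... | block-view b r′ | block-view c i′ = begin
  lookup (hadamardRow (suc p) (block b r′)) (block c i′)
    ≡⟨ hadamard-block p b c r′ i′ ⟩
  sgn (b ∧ c) * lookup (hadamardRow p r′) i′
    ≡⟨ cong (sgn (b ∧ c) *_) (hadamard-entry p r′ i′) ⟩
  sgn (b ∧ c) * sgn (dot (bits p (toℕ r′)) (bits p (toℕ i′)))
    ≡⟨ sgn-xor (b ∧ c) _ ⟨
  sgn ((b ∧ c) xor dot (bits p (toℕ r′)) (bits p (toℕ i′)))
    ≡⟨ cong sgn (dot-∷ʳ (bits p (toℕ r′)) (bits p (toℕ i′)) b c) ⟨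
  sgn (dot (bits p (toℕ r′) ∷ʳ b) (bits p (toℕ i′) ∷ʳ c))
    ≡⟨ cong₂ (λ x y → sgn (dot x y)) (bits-block {p} b r′) (bits-block {p} c i′) ⟨
  sgn (dot (bits (suc p) (toℕ (block b r′))) (bits (suc p) (toℕ (block c i′)))) ∎
  where open ≡-Reasoning

combo-dot : ∀ (z : Vec Bool p) (a : Fin p → Vec Bool n → Bool) y →
            combo z a y ≡ dot z (tabulate (λ j → a j y))
combo-dot []      a y = refl
combo-dot (b ∷ z) a y = cong ((b ∧ a Fin.zero y) xor_) (combo-dot z (a ∘ Fin.suc) y)

sgn-combo≡hadamardRow : ∀ (a : Fin p → Vec Bool n → Bool) y (i : Fin (2 ^ p)) →
  sgn (combo (bits p (toℕ i)) a y) ≡ lookup (hadamardRow p (fromBitsᶠ (tabulate (λ j → a j y)))) i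
sgn-combo≡hadamardRow {p} a y i = begin
  sgn (combo z a y)      ≡⟨ cong sgn (combo-dot z a y) ⟩
  sgn (dot z A)          ≡⟨ cong sgn (dot-comm z A) ⟩
  sgn (dot A z)          ≡⟨ cong (λ v → sgn (dot v z)) (bits-fromBitsᶠ A) ⟨
  sgn (dot (bits p (toℕ (fromBitsᶠ A))) z) ≡⟨ hadamard-entry p (fromBitsᶠ A) i ⟨
  lookup (hadamardRow p (fromBitsᶠ A)) i ∎
  where
  open ≡-Reasoning
  z : Vec Bool p
  z = bits p (toℕ i)
  A : Vec Bool p
  A = tabulate (λ j → a j y)

-- The hypotheses on q and h (and n, p ≠ 0) only concern the ℤ_q-valued function
-- f of the paper; the statement about the g_i holds without them.
proposition1 : (n : ℕ) → .{{NonZero n}} → (q h : ℕ) → 2 ∣ q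
    → 2 ^ (h ∸ 1) < q → q ≤ 2 ^ h
    → (σ : Vec Bool n ↔ Vec Bool n)
    → (p : ℕ) → .{{NonZero p}} → p ≤ h ∸ 1
    → (a : Fin p → Vec Bool n → Bool)
    → ((i : Fin (2 ^ p)) → IsBent (gFun (Inverse.to σ) a i))
      × ((u : Vec Bool n × Vec Bool n) →
          ∃[ r ] ∃[ ε ] ((ε ≡ + 1 ⊎ ε ≡ - (+ 1))
            × ((i : Fin (2 ^ p)) →
                 W (gFun (Inverse.to σ) a i) u ≡ ℚ._/_ (ε ℤ.* lookup (hadamardRow p r) i) 1)))
proposition1 n q h _ _ _ σ p _ a = bent , hadamardRows
  where
  open Inverse σ using (to; from)

  c : Fin (2 ^ p) → Vec Bool n → Bool
  c i = combo (bits p (toℕ i)) a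

  bent : ∀ i → IsBent (gFun to a i)
  bent i (u₁ , u₂) = trans (cong ℚ.∣_∣ (W-maioranaMcFarland σ (c i) u₁ u₂))
                           (∣sgn/1∣≡1 (c i (from u₁) xor dot u₂ (from u₁)))

  hadamardRows : ∀ u → ∃[ r ] ∃[ ε ] ((ε ≡ + 1 ⊎ ε ≡ - (+ 1))
                   × (∀ i → W (gFun to a i) u ≡ (ε * lookup (hadamardRow p r) i) ℚ./ 1))
  hadamardRows (u₁ , u₂) =
    fromBitsᶠ (tabulate (λ j → a j y₀)) , sgn (dot u₂ y₀) , sgn-±1 (dot u₂ y₀) , λ i →
      trans (W-maioranaMcFarland σ (c i) u₁ u₂) (cong (ℚ._/ 1) (begin
        sgn (c i y₀ xor dot u₂ y₀)       ≡⟨ sgn-xor (c i y₀) (dot u₂ y₀) ⟩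
        sgn (c i y₀) * sgn (dot u₂ y₀)   ≡⟨ ℤₚ.*-comm (sgn (c i y₀)) (sgn (dot u₂ y₀)) ⟩
        sgn (dot u₂ y₀) * sgn (c i y₀)   ≡⟨ cong (sgn (dot u₂ y₀) *_) (sgn-combo≡hadamardRow a y₀ i) ⟩
        sgn (dot u₂ y₀) * lookup (hadamardRow p (fromBitsᶠ (tabulate (λ j → a j y₀)))) i ∎))
    where
    open ≡-Reasoning
    y₀ : Vec Bool n
    y₀ = from u₁
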